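{- Let $n, l$ be positive integers and let $p$ be a prime such that $p^l$ divides $n$ but $p^{l+1}$ does not divide $n$. Let $S$ be a subset of $\mathbb{Z}_n$ with $0 \notin S$, $S = -S$, and $|S| = p^l$, such that the circulant graph $\mathrm{Cay}(\mathbb{Z}_n, S)$ is connected. Then $\mathrm{Cay}(\mathbb{Z}_n, S)$ admits a total perfect code if and only if $s \not\equiv s' \pmod{p^l}$ for all distinct $s, s' \in S$.
   Context: For a finite group $G$ and an inverse-closed subset $X \subseteq G$ not containing the identity, the Cayley graph $\mathrm{Cay}(G,X)$ has vertex set $G$, with $u,v$ adjacent iff $vu^{ -1} \in X$. A circulant graph is a Cayley graph $\mathrm{Cay}(\mathbb{Z}_n, S)$ on the additive cyclic group $\mathbb{Z}_n$; its degree is $|S|$. A total perfect code in a graph $\Gamma=(V,E)$ is a subset $C \subseteq V$ such that every vertex of $\Gamma$ has exactly one neighbour in $C$. Since $p^l \mid n$, congruence modulo $p^l$ of elements of $\mathbb{Z}_n$ is well defined. -}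

module Defs where

open import Data.Nat using (ℕ; zero; suc; _+_; _∸_)
open import Data.Nat.DivMod using (_mod_)
open import Data.Fin using (Fin; toℕ)
open import Data.Fin.Subset using (Subset; _∈_)
open import Data.Product using (Σ; _×_)
open import Relation.Binary.PropositionalEquality using (_≡_)

infixl 6 _⊕_ _⊖_

_⊕_ : ∀ {n} → Fin (suc n) → Fin (suc n) → Fin (suc n)
_⊕_ {n} a b = (toℕ a + toℕ b) mod suc n

⊝_ : ∀ {n} → Fin (suc n) → Fin (suc n)
⊝_ {n} a = (suc n ∸ toℕ a) mod suc n

_⊖_ : ∀ {n} → Fin (suc n) → Fin (suc n) → Fin (suc n)
a ⊖ b = a ⊕ (⊝ b)

Adj : ∀ {n} → Subset (suc n) → Fin (suc n) → Fin (suc n) → Set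
Adj S u v = (v ⊖ u) ∈ S

data Reach {n} (S : Subset (suc n)) : Fin (suc n) → Fin (suc n) → Set where
  here : ∀ {u} → Reach S u u
  step : ∀ {u v w} → Adj S u v → Reach S v w → Reach S u w

Connected : ∀ {n} → Subset (suc n) → Set
Connected S = ∀ u v → Reach S u v

IsTotalPerfectCode : ∀ {n} → Subset (suc n) → Subset (suc n) → Set
IsTotalPerfectCode S C =
  ∀ v → Σ _ λ c → (c ∈ C × Adj S v c) ×
        (∀ c′ → c′ ∈ C → Adj S v c′ → c′ ≡ c)

HasTotalPerfectCode : ∀ {n} → Subset (suc n) → Set
HasTotalPerfectCode S = Σ _ λ C → IsTotalPerfectCode S C

module Submission where

-- Let t = p^l and regard the indicators X of a total perfect code C and 𝟙S of S as elements of
-- the group semiring ℕ[ℤₙ]. As S = −S, the code condition says that X ⋆ 𝟙S is constantly 1, so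
-- |C|·t = n and p ∤ |C|, and X^t ⋆ 𝟙S is constantly |C|^(t−1), which is prime to p. Modulo p the
-- t-th power is additive (Frobenius), hence X^t ≡ Y := Σ_{c∈C} δ_{tc}; so Y ⋆ 𝟙S vanishes nowhere,
-- and having total mass |C|·t = n it is constantly 1. Since Y lives on the subgroup tℤₙ,
-- convolving with Y preserves residue classes modulo t: each class, of size n/t = |C|, meets S
-- in exactly one element. Conversely, if S is a complete residue system modulo t, the multiples
-- of t form a total perfect code.

open import Level using (0ℓ)
open import Algebra.Bundles using (CommutativeSemiring)
import Data.Nat.Base as ℕ
open import Data.Nat.Base using (ℕ; zero; suc; _≤_; _<_; z≤n; s≤s) renaming (_^_ to _^ℕ_)
open import Data.Nat.Combinatorics using (_C_; nCn≡1)
open import Data.Nat.Divisibility using (_∣_; divides)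
open import Data.Nat.Properties using (n∸n≡0)
open import Data.Fin.Base using (Fin; toℕ; fromℕ; inject₁) renaming (zero to fzero; suc to fsuc)
open import Data.Fin.Properties using (toℕ-fromℕ; toℕ-inject₁; toℕ<n)
open import Function.Base using (_∘_)
open import Relation.Binary.PropositionalEquality as ≡ using (_≡_)

module Frobenius {c ℓ} (R : CommutativeSemiring c ℓ) where

  open CommutativeSemiring R
  open import Algebra.Definitions.RawSemiring rawSemiring using (_^_) renaming (_×_ to _·_)
  open import Algebra.Properties.Monoid.Mult +-monoid using (×-congʳ; ×-homo-1; ×-assocˡ)
  open import Algebra.Properties.Semiring.Exp semiring using (^-congˡ; ^-assocʳ)
  open import Algebra.Properties.Semiring.Sum semiring
    using (sum-cong-≋; sum-init-last; sum-replicate-zero) renaming (sum to ∑)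
  import Algebra.Properties.CommutativeSemiring.Binomial R as Binomial
  open import Relation.Binary.Reasoning.Setoid setoid

  ·-zeroʳ : ∀ j → j · 0# ≈ 0#
  ·-zeroʳ zero = refl
  ·-zeroʳ (suc j) = trans (+-identityˡ (j · 0#)) (·-zeroʳ j)

  sum-ends : ∀ {m} (g : Fin (suc (suc m)) → Carrier) → (∀ i → g (fsuc (inject₁ i)) ≈ 0#) →
             ∑ g ≈ g fzero + g (fromℕ (suc m))
  sum-ends {m} g middle = +-congˡ (begin
    ∑ (g ∘ fsuc)                                         ≈⟨ sum-init-last (g ∘ fsuc) ⟩
    ∑ (λ i → g (fsuc (inject₁ i))) + g (fromℕ (suc m))   ≈⟨ +-congʳ (sum-cong-≋ middle) ⟩
    ∑ {m} (λ _ → 0#) + g (fromℕ (suc m))                 ≈⟨ +-congʳ (sum-replicate-zero m) ⟩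
    0# + g (fromℕ (suc m))                               ≈⟨ +-identityˡ _ ⟩
    g (fromℕ (suc m))                                    ∎)

  AdditivePower : ℕ → Set _
  AdditivePower e = ∀ x y → (x + y) ^ e ≈ x ^ e + y ^ e

  frobenius : ∀ {n} → 2 ≤ n → (∀ k → 0 < k → k < n → n ∣ n C k) → (∀ x → n · x ≈ 0#) → AdditivePower n
  frobenius {suc zero} (s≤s ())
  frobenius {n@(suc (suc m))} _ n∣nCk char-n x y = begin
    (x + y) ^ n                          ≈⟨ Binomial.theorem n x y ⟩
    ∑ (term n)                           ≈⟨ sum-ends (term n) middle ⟩
    term n fzero + term n (fromℕ n)      ≈⟨ +-cong first last ⟩
    y ^ n + x ^ n                        ≈⟨ +-comm (y ^ n) (x ^ n) ⟩
    x ^ n + y ^ n                        ∎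
    where
    term = Binomial.binomialTerm x y
    first : term n fzero ≈ y ^ n
    first = trans (×-homo-1 _) (*-identityˡ (y ^ n))
    last : term n (fromℕ n) ≈ x ^ n
    last = begin
      (n C toℕ (fromℕ n)) · (x ^ toℕ (fromℕ n) * y ^ (n ℕ.∸ toℕ (fromℕ n)))
        ≡⟨ ≡.cong (λ k → (n C k) · (x ^ k * y ^ (n ℕ.∸ k))) (toℕ-fromℕ n) ⟩
      (n C n) · (x ^ n * y ^ (n ℕ.∸ n))
        ≡⟨ ≡.cong₂ (λ a b → a · (x ^ n * y ^ b)) (nCn≡1 n) (n∸n≡0 n) ⟩
      1 · (x ^ n * 1#)
        ≈⟨ trans (×-homo-1 _) (*-identityʳ (x ^ n)) ⟩
      x ^ n ∎
    middle : ∀ i → term n (fsuc (inject₁ i)) ≈ 0#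
    middle i with n∣nCk (suc (toℕ (inject₁ i))) (s≤s z≤n)
                         (s≤s (≡.subst (_< suc m) (≡.sym (toℕ-inject₁ i)) (toℕ<n i)))
    ... | divides j nCk≡j*n = begin
      (n C k) · b       ≡⟨ ≡.cong (_· b) nCk≡j*n ⟩
      (j ℕ.* n) · b     ≈⟨ ×-assocˡ b j n ⟨
      j · (n · b)       ≈⟨ ×-congʳ j (char-n b) ⟩
      j · 0#            ≈⟨ ·-zeroʳ j ⟩
      0#                ∎
      where
      k = suc (toℕ (inject₁ i))
      b = Binomial.binomial x y n (fsuc (inject₁ i))

  AdditivePower-^ : ∀ {e} → AdditivePower e → ∀ j → AdditivePower (e ^ℕ j)
  AdditivePower-^ _ zero x y = distribʳ 1# x y
  AdditivePower-^ {e} additive (suc j) x y = begin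
    (x + y) ^ (e ℕ.* e ^ℕ j)                   ≈⟨ ^-assocʳ (x + y) e (e ^ℕ j) ⟨
    ((x + y) ^ e) ^ (e ^ℕ j)                   ≈⟨ ^-congˡ (e ^ℕ j) (additive x y) ⟩
    (x ^ e + y ^ e) ^ (e ^ℕ j)                 ≈⟨ AdditivePower-^ additive j (x ^ e) (y ^ e) ⟩
    (x ^ e) ^ (e ^ℕ j) + (y ^ e) ^ (e ^ℕ j)    ≈⟨ +-cong (^-assocʳ x e (e ^ℕ j)) (^-assocʳ y e (e ^ℕ j)) ⟩
    x ^ (e ℕ.* e ^ℕ j) + y ^ (e ℕ.* e ^ℕ j)    ∎

  AdditivePower-sum : ∀ {e} → 1 ≤ e → AdditivePower e →
                      ∀ {k} (T : Fin k → Carrier) → ∑ T ^ e ≈ ∑ (λ i → T i ^ e)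
  AdditivePower-sum {suc e} _ _ {zero} T = zeroˡ (0# ^ e)
  AdditivePower-sum 1≤e additive {suc k} T =
    trans (additive (T fzero) (∑ (T ∘ fsuc))) (+-congˡ (AdditivePower-sum 1≤e additive (T ∘ fsuc)))

-- Opened only here: inside Frobenius they would clash with the semiring's _+_, _*_, refl, ….
open import Data.Nat.Base using (_+_; _*_; _∸_; NonZero; ∣_-_∣; nonTrivial⇒n>1; nonTrivial⇒≢1; _!)
open import Data.Nat.Properties
open import Data.Nat.DivMod
open import Data.Nat.Divisibility
  using (∣-refl; _∣?_; m%n≡0⇒n∣m; n∣m⇒m%n≡0; ∣⇒≤; ∣1⇒≡1; m∣m*n; *-monoˡ-∣)
open import Data.Nat.Primality using (Prime; euclidsLemma; prime⇒nonZero; prime⇒nonTrivial)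
open import Data.Nat.Combinatorics using (nCk≡n!/k![n-k]!; k![n∸k]!∣n!)
open import Data.Fin.Base using (fromℕ<; _↑ˡ_; _↑ʳ_)
open import Data.Fin.Properties using (toℕ-fromℕ<; toℕ-injective; toℕ-↑ˡ; toℕ-↑ʳ)
  renaming (suc-injective to fsuc-injective; _≟_ to _≟ᶠ_)
open import Data.Fin.Permutation using (permutation)
open import Data.Fin.Subset using (Subset; _∈_; _∉_; ∣_∣; inside; outside)
open import Data.Fin.Subset.Properties using (_∈?_)
open import Data.Bool.Base using (if_then_else_)
open import Data.Vec.Base using ([]; _∷_; tabulate)
open import Data.Vec.Properties using ([]=⇒lookup; lookup⇒[]=; lookup∘tabulate)
open import Data.Product.Base using (∃; _×_; _,_; proj₁; proj₂)
open import Data.Sum.Base using (inj₁; inj₂)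
open import Data.Empty using (⊥-elim)
open import Function.Bundles using (_⇔_; mk⇔; Equivalence)
open import Relation.Nullary using (¬_; Dec; does; yes; no; _×-dec_)
open import Relation.Nullary.Decidable using (decidable-stable; dec-true)
open import Relation.Binary.PropositionalEquality
open import Relation.Binary.Bundles using (Setoid)
open import Relation.Binary.Structures using (IsEquivalence)
import Relation.Binary.Reasoning.Setoid as SetoidReasoning
open import Algebra.Structures.Biased using (IsCommutativeSemiringˡ)
open import Algebra.Properties.Semiring.Sum +-*-semiring
  using (sum; sum-cong-≗; ∑-comm; ∑-distrib-+; *-distribˡ-sum; *-distribʳ-sum; sum-replicate-zero; sum-permute)

open import Defs

infix 4 _≡_[mod_]
record _≡_[mod_] (x y d : ℕ) .{{_ : NonZero d}} : Set where
  constructor mod-≡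
  field %-≡ : x % d ≡ y % d
open _≡_[mod_] public

module _ {d : ℕ} .{{_ : NonZero d}} where

  ≡⇒≡[mod] : ∀ {x y} → x ≡ y → x ≡ y [mod d ]
  ≡⇒≡[mod] refl = mod-≡ refl

  ≡[mod]-setoid : Setoid _ _
  ≡[mod]-setoid = record
    { Carrier = ℕ
    ; _≈_ = λ x y → x ≡ y [mod d ]
    ; isEquivalence = record
      { refl = mod-≡ refl
      ; sym = λ (mod-≡ e) → mod-≡ (sym e)
      ; trans = λ (mod-≡ e) (mod-≡ e′) → mod-≡ (trans e e′) } }

  open Setoid ≡[mod]-setoid public
    using () renaming (refl to ≡[mod]-refl; sym to ≡[mod]-sym; trans to ≡[mod]-trans)

  +-cong-≡[mod] : ∀ {a b c e} → a ≡ b [mod d ] → c ≡ e [mod d ] → a + c ≡ b + e [mod d ]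
  +-cong-≡[mod] {a} {b} {c} {e} (mod-≡ p) (mod-≡ q) = mod-≡ (begin
    (a + c) % d             ≡⟨ %-distribˡ-+ a c d ⟩
    (a % d + c % d) % d     ≡⟨ cong₂ (λ u v → (u + v) % d) p q ⟩
    (b % d + e % d) % d     ≡⟨ %-distribˡ-+ b e d ⟨
    (b + e) % d             ∎)
    where open ≡-Reasoning

  *-cong-≡[mod] : ∀ {a b c e} → a ≡ b [mod d ] → c ≡ e [mod d ] → a * c ≡ b * e [mod d ]
  *-cong-≡[mod] {a} {b} {c} {e} (mod-≡ p) (mod-≡ q) = mod-≡ (begin
    (a * c) % d             ≡⟨ %-distribˡ-* a c d ⟩
    (a % d * (c % d)) % d   ≡⟨ cong₂ (λ u v → (u * v) % d) p q ⟩
    (b % d * (e % d)) % d   ≡⟨ %-distribˡ-* b e d ⟨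
    (b * e) % d             ∎)
    where open ≡-Reasoning

  +-congˡ-≡[mod] : ∀ a {x y} → x ≡ y [mod d ] → a + x ≡ a + y [mod d ]
  +-congˡ-≡[mod] a = +-cong-≡[mod] (≡[mod]-refl {a})

  m%d≡m[mod] : ∀ x → x % d ≡ x [mod d ]
  m%d≡m[mod] x = mod-≡ (m%n%n≡m%n x d)

  ∣⇒≡0[mod] : ∀ {x} → d ∣ x → x ≡ 0 [mod d ]
  ∣⇒≡0[mod] {x} d∣x = mod-≡ (trans (n∣m⇒m%n≡0 x d d∣x) (sym (m*n%n≡0 0 d)))

  ≡0[mod]⇒∣ : ∀ {x} → x ≡ 0 [mod d ] → d ∣ x
  ≡0[mod]⇒∣ {x} (mod-≡ e) = m%n≡0⇒n∣m x d (trans e (m*n%n≡0 0 d))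

  -- Writing both sides as remainder plus multiple of d, the remainders cancel.
  m+n≡m[mod]⇒∣n : ∀ m n → m + n ≡ m [mod d ] → d ∣ n
  m+n≡m[mod]⇒∣n m n (mod-≡ e) = divides ((m + n) / d ∸ m / d) (begin
    n                                                  ≡⟨ m+n∸m≡n m n ⟨
    (m + n) ∸ m                                        ≡⟨ cong₂ _∸_ (m≡m%n+[m/n]*n (m + n) d) (m≡m%n+[m/n]*n m d) ⟩
    ((m + n) % d + (m + n) / d * d) ∸ (m % d + m / d * d) ≡⟨ cong (λ r → (r + (m + n) / d * d) ∸ (m % d + m / d * d)) e ⟩
    (m % d + (m + n) / d * d) ∸ (m % d + m / d * d)    ≡⟨ [m+n]∸[m+o]≡n∸o (m % d) _ _ ⟩
    (m + n) / d * d ∸ m / d * d                        ≡⟨ *-distribʳ-∸ d ((m + n) / d) (m / d) ⟨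
    ((m + n) / d ∸ m / d) * d                          ∎)
    where open ≡-Reasoning

  ∣n⇒m+n≡m[mod] : ∀ m {n} → d ∣ n → m + n ≡ m [mod d ]
  ∣n⇒m+n≡m[mod] m (divides k refl) = mod-≡ ([m+kn]%n≡m%n m k d)

  ≡[mod]⇒∣∣-∣ : ∀ x y → x ≡ y [mod d ] → d ∣ ∣ x - y ∣
  ≡[mod]⇒∣∣-∣ x y x≡y with ≤-total x y
  ... | inj₁ x≤y = subst (d ∣_) (sym (m≤n⇒∣m-n∣≡n∸m x≤y))
        (m+n≡m[mod]⇒∣n x (y ∸ x) (≡[mod]-trans (≡⇒≡[mod] (m+[n∸m]≡n x≤y)) (≡[mod]-sym x≡y)))
  ... | inj₂ y≤x = subst (d ∣_) (sym (m≤n⇒∣n-m∣≡n∸m y≤x))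
        (m+n≡m[mod]⇒∣n y (x ∸ y) (≡[mod]-trans (≡⇒≡[mod] (m+[n∸m]≡n y≤x)) x≡y))

  ∣∣-∣⇒≡[mod] : ∀ x y → d ∣ ∣ x - y ∣ → x ≡ y [mod d ]
  ∣∣-∣⇒≡[mod] x y d∣ with ≤-total x y
  ... | inj₁ x≤y = ≡[mod]-sym (≡[mod]-trans (≡⇒≡[mod] (sym (m+[n∸m]≡n x≤y)))
        (∣n⇒m+n≡m[mod] x (subst (d ∣_) (m≤n⇒∣m-n∣≡n∸m x≤y) d∣)))
  ... | inj₂ y≤x = ≡[mod]-trans (≡⇒≡[mod] (sym (m+[n∸m]≡n y≤x)))
        (∣n⇒m+n≡m[mod] y (subst (d ∣_) (m≤n⇒∣n-m∣≡n∸m y≤x) d∣))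

  +-cancelˡ-≡[mod] : ∀ a {x y} → a + x ≡ a + y [mod d ] → x ≡ y [mod d ]
  +-cancelˡ-≡[mod] a {x} {y} h =
    ∣∣-∣⇒≡[mod] x y (subst (d ∣_) (∣m+n-m+o∣≡∣n-o∣ a x y) (≡[mod]⇒∣∣-∣ (a + x) (a + y) h))

  ≡[mod]-∣ : ∀ {t x y} .{{_ : NonZero t}} → t ∣ d → x ≡ y [mod d ] → x ≡ y [mod t ]
  ≡[mod]-∣ {t} {x} {y} t∣d (mod-≡ e) = mod-≡ (begin
    x % t      ≡⟨ m∣n⇒o%n%m≡o%m t d x t∣d ⟨
    x % d % t  ≡⟨ cong (_% t) e ⟩
    y % d % t  ≡⟨ m∣n⇒o%n%m≡o%m t d y t∣d ⟩
    y % t      ∎)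
    where open ≡-Reasoning

  ∤∧≡[mod]⇒1≤ : ∀ {x y} → ¬ d ∣ x → x ≡ y [mod d ] → 1 ≤ y
  ∤∧≡[mod]⇒1≤ {y = zero} d∤x x≡0 = ⊥-elim (d∤x (≡0[mod]⇒∣ x≡0))
  ∤∧≡[mod]⇒1≤ {y = suc _} _ _ = s≤s z≤n

  <⇒≡[mod]⇒≡ : ∀ {x y} → x < d → y < d → x ≡ y [mod d ] → x ≡ y
  <⇒≡[mod]⇒≡ x<d y<d (mod-≡ e) = trans (sym (m<n⇒m%n≡m x<d)) (trans e (m<n⇒m%n≡m y<d))

module _ {p : ℕ} (p-prime : Prime p) where

  private instance
    p≢0 : NonZero p
    p≢0 = prime⇒nonZero p-prime

  prime∤1 : ¬ p ∣ 1
  prime∤1 p∣1 = nonTrivial⇒≢1 {{prime⇒nonTrivial p-prime}} (∣1⇒≡1 p∣1)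

  prime∤j! : ∀ j → j < p → ¬ p ∣ j !
  prime∤j! zero _ = prime∤1
  prime∤j! (suc j) j<p p∣j! with euclidsLemma (suc j) (j !) p-prime p∣j!
  ... | inj₁ p∣1+j = <⇒≱ j<p (∣⇒≤ p∣1+j)
  ... | inj₂ p∣j! = prime∤j! j (<-trans (n<1+n j) j<p) p∣j!

  prime∤^ : ∀ {k} → ¬ p ∣ k → ∀ e → ¬ p ∣ k ^ℕ e
  prime∤^ _ zero = prime∤1
  prime∤^ {k} p∤k (suc e) p∣k^[1+e] with euclidsLemma k (k ^ℕ e) p-prime p∣k^[1+e]
  ... | inj₁ p∣k = p∤k p∣k
  ... | inj₂ p∣k^e = prime∤^ p∤k e p∣k^e

  -- p divides p! = (p C k) · k! · (p ∸ k)!, but neither factorial.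
  prime∣pCk : ∀ k → 0 < k → k < p → p ∣ p C k
  prime∣pCk k 0<k k<p with euclidsLemma (p C k) (k ! * (p ∸ k) !) p-prime p∣pCk*k!*[p∸k]!
    where
    instance
      k![p∸k]!≢0 : NonZero (k ! * (p ∸ k) !)
      k![p∸k]!≢0 = k !* (p ∸ k) !≢0
    p∣pCk*k!*[p∸k]! : p ∣ (p C k) * (k ! * (p ∸ k) !)
    p∣pCk*k!*[p∸k]! = subst (p ∣_)
      (sym (trans (cong (_* (k ! * (p ∸ k) !)) (nCk≡n!/k![n-k]! (<⇒≤ k<p))) (m/n*n≡m (k![n∸k]!∣n! (<⇒≤ k<p)))))
      (n∣n! p)
      where
      n∣n! : ∀ n .{{_ : NonZero n}} → n ∣ n !
      n∣n! (suc n) = m∣m*n (n !)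
  ... | inj₁ p∣pCk = p∣pCk
  ... | inj₂ p∣k!*[p∸k]! with euclidsLemma (k !) ((p ∸ k) !) p-prime p∣k!*[p∸k]!
  ...   | inj₁ p∣k! = ⊥-elim (prime∤j! k k<p p∣k!)
  ...   | inj₂ p∣[p∸k]! = ⊥-elim (prime∤j! (p ∸ k) (∸-monoʳ-< 0<k (<⇒≤ k<p)) p∣[p∸k]!)

module _ {n : ℕ} where

  private
    N : ℕ
    N = suc n

    open SetoidReasoning (≡[mod]-setoid {N})

  toℕ-mod : ∀ x → toℕ (x mod N) ≡ x [mod N ]
  toℕ-mod x = mod-≡ (trans (cong (_% N) (toℕ-fromℕ< (m%n<n x N))) (m%n%n≡m%n x N))

  toℕ-injective-≡[mod] : {a b : Fin N} → toℕ a ≡ toℕ b [mod N ] → a ≡ b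
  toℕ-injective-≡[mod] = toℕ-injective ∘ <⇒≡[mod]⇒≡ (toℕ<n _) (toℕ<n _)

  toℕ-⊕ : ∀ (a b : Fin N) → toℕ (a ⊕ b) ≡ toℕ a + toℕ b [mod N ]
  toℕ-⊕ a b = toℕ-mod (toℕ a + toℕ b)

  toℕ+toℕ-⊝ : ∀ (a : Fin N) → toℕ a + toℕ (⊝ a) ≡ 0 [mod N ]
  toℕ+toℕ-⊝ a = begin
    toℕ a + toℕ (⊝ a)   ≈⟨ +-congˡ-≡[mod] (toℕ a) (toℕ-mod (N ∸ toℕ a)) ⟩
    toℕ a + (N ∸ toℕ a) ≡⟨ m+[n∸m]≡n (<⇒≤ (toℕ<n a)) ⟩
    N                   ≈⟨ ∣⇒≡0[mod] ∣-refl ⟩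
    0                   ∎

  toℕ-⊖ : ∀ (a b : Fin N) → toℕ b + toℕ (a ⊖ b) ≡ toℕ a [mod N ]
  toℕ-⊖ a b = begin
    toℕ b + toℕ (a ⊖ b)          ≈⟨ +-congˡ-≡[mod] (toℕ b) (toℕ-⊕ a (⊝ b)) ⟩
    toℕ b + (toℕ a + toℕ (⊝ b))  ≡⟨ +-comm (toℕ b) _ ⟩
    toℕ a + toℕ (⊝ b) + toℕ b    ≡⟨ +-assoc (toℕ a) _ _ ⟩
    toℕ a + (toℕ (⊝ b) + toℕ b)  ≡⟨ cong (toℕ a +_) (+-comm (toℕ (⊝ b)) (toℕ b)) ⟩
    toℕ a + (toℕ b + toℕ (⊝ b))  ≈⟨ +-congˡ-≡[mod] (toℕ a) (toℕ+toℕ-⊝ b) ⟩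
    toℕ a + 0                    ≡⟨ +-identityʳ (toℕ a) ⟩
    toℕ a                        ∎

  ⊖-unique : ∀ (a b c : Fin N) → toℕ b + toℕ c ≡ toℕ a [mod N ] → c ≡ a ⊖ b
  ⊖-unique a b c h = toℕ-injective-≡[mod] (+-cancelˡ-≡[mod] (toℕ b) (≡[mod]-trans h (≡[mod]-sym (toℕ-⊖ a b))))

  [a⊕b]⊖a≡b : ∀ (a b : Fin N) → (a ⊕ b) ⊖ a ≡ b
  [a⊕b]⊖a≡b a b = sym (⊖-unique (a ⊕ b) a b (≡[mod]-sym (toℕ-⊕ a b)))

  a⊕[b⊖a]≡b : ∀ (a b : Fin N) → a ⊕ (b ⊖ a) ≡ b
  a⊕[b⊖a]≡b a b = toℕ-injective-≡[mod] (≡[mod]-trans (toℕ-⊕ a (b ⊖ a)) (toℕ-⊖ b a))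

  a⊖[a⊖b]≡b : ∀ (a b : Fin N) → a ⊖ (a ⊖ b) ≡ b
  a⊖[a⊖b]≡b a b = sym (⊖-unique a (a ⊖ b) b
    (≡[mod]-trans (≡⇒≡[mod] (+-comm (toℕ (a ⊖ b)) (toℕ b))) (toℕ-⊖ a b)))

  a⊖0≡a : ∀ (a : Fin N) → a ⊖ fzero ≡ a
  a⊖0≡a a = sym (⊖-unique a fzero a ≡[mod]-refl)

  a⊖[b⊕c]≡a⊖b⊖c : ∀ (a b c : Fin N) → a ⊖ (b ⊕ c) ≡ (a ⊖ b) ⊖ c
  a⊖[b⊕c]≡a⊖b⊖c a b c = sym (⊖-unique a (b ⊕ c) ((a ⊖ b) ⊖ c) (begin
    toℕ (b ⊕ c) + toℕ ((a ⊖ b) ⊖ c)      ≈⟨ +-cong-≡[mod] (toℕ-⊕ b c) ≡[mod]-refl ⟩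
    toℕ b + toℕ c + toℕ ((a ⊖ b) ⊖ c)    ≡⟨ +-assoc (toℕ b) _ _ ⟩
    toℕ b + (toℕ c + toℕ ((a ⊖ b) ⊖ c))  ≈⟨ +-congˡ-≡[mod] (toℕ b) (toℕ-⊖ (a ⊖ b) c) ⟩
    toℕ b + toℕ (a ⊖ b)                  ≈⟨ toℕ-⊖ a b ⟩
    toℕ a                                ∎))

  ⊝[a⊖b]≡b⊖a : ∀ (a b : Fin N) → ⊝ (a ⊖ b) ≡ b ⊖ a
  ⊝[a⊖b]≡b⊖a a b = ⊖-unique b a (⊝ (a ⊖ b)) (begin
    toℕ a + toℕ (⊝ (a ⊖ b))                    ≈⟨ +-cong-≡[mod] (≡[mod]-sym (toℕ-⊖ a b)) ≡[mod]-refl ⟩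
    toℕ b + toℕ (a ⊖ b) + toℕ (⊝ (a ⊖ b))      ≡⟨ +-assoc (toℕ b) _ _ ⟩
    toℕ b + (toℕ (a ⊖ b) + toℕ (⊝ (a ⊖ b)))    ≈⟨ +-congˡ-≡[mod] (toℕ b) (toℕ+toℕ-⊝ (a ⊖ b)) ⟩
    toℕ b + 0                                  ≡⟨ +-identityʳ (toℕ b) ⟩
    toℕ b                                      ∎)

infixr 7 _⊛_
_⊛_ : ∀ {n} → ℕ → Fin (suc n) → Fin (suc n)
_⊛_ {n} k c = (k * toℕ c) mod suc n

c⊕k⊛c≡[1+k]⊛c : ∀ {n} k (c : Fin (suc n)) → c ⊕ k ⊛ c ≡ suc k ⊛ c
c⊕k⊛c≡[1+k]⊛c {n} k c = toℕ-injective-≡[mod] (begin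
  toℕ (c ⊕ k ⊛ c)           ≈⟨ toℕ-⊕ c (k ⊛ c) ⟩
  toℕ c + toℕ (k ⊛ c)       ≈⟨ +-congˡ-≡[mod] (toℕ c) (toℕ-mod (k * toℕ c)) ⟩
  toℕ c + k * toℕ c         ≈⟨ toℕ-mod (suc k * toℕ c) ⟨
  toℕ (suc k ⊛ c)           ∎)
  where open SetoidReasoning (≡[mod]-setoid {suc n})

𝟙 : {P : Set} → Dec P → ℕ
𝟙 P? = if does P? then 1 else 0

𝟙-yes : ∀ {P} (P? : Dec P) → P → 𝟙 P? ≡ 1
𝟙-yes (yes _) _ = refl
𝟙-yes (no ¬p) p = ⊥-elim (¬p p)

𝟙-no : ∀ {P} (P? : Dec P) → ¬ P → 𝟙 P? ≡ 0
𝟙-no (yes p) ¬p = ⊥-elim (¬p p)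
𝟙-no (no _) _ = refl

𝟙≤1 : ∀ {P} (P? : Dec P) → 𝟙 P? ≤ 1
𝟙≤1 (yes _) = ≤-refl
𝟙≤1 (no _) = z≤n

𝟙-× : ∀ {P Q} (P? : Dec P) (Q? : Dec Q) → 𝟙 (P? ×-dec Q?) ≡ 𝟙 P? * 𝟙 Q?
𝟙-× (yes _) (yes _) = refl
𝟙-× (yes _) (no _) = refl
𝟙-× (no _) _ = refl

𝟙-cong : ∀ {P Q} (P? : Dec P) (Q? : Dec Q) → P ⇔ Q → 𝟙 P? ≡ 𝟙 Q?
𝟙-cong (yes _) (yes _) _ = refl
𝟙-cong (no _) (no _) _ = refl
𝟙-cong (yes p) (no ¬q) P⇔Q = ⊥-elim (¬q (Equivalence.to P⇔Q p))
𝟙-cong (no ¬p) (yes q) P⇔Q = ⊥-elim (¬p (Equivalence.from P⇔Q q))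

𝟙-witness : ∀ {P} (P? : Dec P) → 1 ≤ 𝟙 P? → P
𝟙-witness (yes p) _ = p

∣S∣≡sum𝟙 : ∀ {k} (S : Subset k) → ∣ S ∣ ≡ sum (λ v → 𝟙 (v ∈? S))
∣S∣≡sum𝟙 [] = refl
∣S∣≡sum𝟙 (inside ∷ S) = cong suc (∣S∣≡sum𝟙 S)
∣S∣≡sum𝟙 (outside ∷ S) = ∣S∣≡sum𝟙 S

sum-replicate-1 : ∀ k → sum {k} (λ _ → 1) ≡ k
sum-replicate-1 zero = refl
sum-replicate-1 (suc k) = cong suc (sum-replicate-1 k)

sum-single : ∀ {k} (f : Fin k → ℕ) a → (∀ i → i ≢ a → f i ≡ 0) → sum f ≡ f a
sum-single {suc k} f fzero h = begin
  f fzero + sum (f ∘ fsuc)          ≡⟨ cong (f fzero +_) (sum-cong-≗ (λ i → h (fsuc i) λ ())) ⟩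
  f fzero + sum {k} (λ _ → 0)       ≡⟨ cong (f fzero +_) (sum-replicate-zero k) ⟩
  f fzero + 0                       ≡⟨ +-identityʳ (f fzero) ⟩
  f fzero                           ∎
  where open ≡-Reasoning
sum-single {suc k} f (fsuc a) h =
  cong₂ _+_ (h fzero λ ()) (sum-single (f ∘ fsuc) a λ i i≢a → h (fsuc i) (i≢a ∘ fsuc-injective))

sum-cong-≡[mod] : ∀ {k d} .{{_ : NonZero d}} {f g : Fin k → ℕ} →
                  (∀ i → f i ≡ g i [mod d ]) → sum f ≡ sum g [mod d ]
sum-cong-≡[mod] {zero} h = ≡[mod]-refl
sum-cong-≡[mod] {suc k} h = +-cong-≡[mod] (h fzero) (sum-cong-≡[mod] (h ∘ fsuc))

f≤sum : ∀ {k} (f : Fin k → ℕ) a → f a ≤ sum f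
f≤sum f fzero = m≤m+n _ _
f≤sum f (fsuc a) = ≤-trans (f≤sum (f ∘ fsuc) a) (m≤n+m _ _)

sum-mono-≤ : ∀ {k} {f g : Fin k → ℕ} → (∀ i → f i ≤ g i) → sum f ≤ sum g
sum-mono-≤ {zero} h = z≤n
sum-mono-≤ {suc k} h = +-mono-≤ (h fzero) (sum-mono-≤ (h ∘ fsuc))

2≤sum : ∀ {k} (f : Fin k → ℕ) a b → a ≢ b → 1 ≤ f a → 1 ≤ f b → 2 ≤ sum f
2≤sum f fzero fzero a≢b _ _ = ⊥-elim (a≢b refl)
2≤sum f fzero (fsuc b) _ fa fb = +-mono-≤ fa (≤-trans fb (f≤sum (f ∘ fsuc) b))
2≤sum f (fsuc a) fzero _ fa fb = subst (2 ≤_) (+-comm _ (f fzero)) (+-mono-≤ (≤-trans fa (f≤sum (f ∘ fsuc) a)) fb)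
2≤sum f (fsuc a) (fsuc b) a≢b fa fb = ≤-trans (2≤sum (f ∘ fsuc) a b (a≢b ∘ cong fsuc) fa fb) (m≤n+m _ _)

1≤sum⇒∃ : ∀ {k} (f : Fin k → ℕ) → 1 ≤ sum f → ∃ λ i → 1 ≤ f i
1≤sum⇒∃ {suc k} f h with f fzero in eq
... | suc _ = fzero , subst (1 ≤_) (sym eq) (s≤s z≤n)
... | zero = let (i , fi) = 1≤sum⇒∃ (f ∘ fsuc) h in fsuc i , fi

sum-mono-≤-≡⇒≡ : ∀ {k} {f g : Fin k → ℕ} → (∀ i → f i ≤ g i) → sum f ≡ sum g → ∀ i → f i ≡ g i
sum-mono-≤-≡⇒≡ {suc k} {f} {g} f≤g e = pointwise
  where
  head≡ : f fzero ≡ g fzero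
  head≡ = ≤-antisym (f≤g fzero) (+-cancelʳ-≤ (sum (f ∘ fsuc)) _ _
    (≤-trans (+-monoʳ-≤ (g fzero) (sum-mono-≤ (f≤g ∘ fsuc))) (≤-reflexive (sym e))))
  pointwise : ∀ i → f i ≡ g i
  pointwise fzero = head≡
  pointwise (fsuc i) = sum-mono-≤-≡⇒≡ (f≤g ∘ fsuc)
    (+-cancelˡ-≡ (g fzero) _ _ (trans (cong (_+ sum (f ∘ fsuc)) (sym head≡)) e)) i

sum≤1 : ∀ {k} (f : Fin k → ℕ) → (∀ i → f i ≤ 1) → (∀ i j → 1 ≤ f i → 1 ≤ f j → i ≡ j) → sum f ≤ 1
sum≤1 f f≤1 unique with 1 ≤? sum f
... | no sum≱1 = <⇒≤ (≰⇒> sum≱1)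
... | yes sum≥1 with 1≤sum⇒∃ f sum≥1
...   | i , fi≥1 = subst (_≤ 1) (sym (sum-single f i vanish)) (f≤1 i)
  where
  vanish : ∀ j → j ≢ i → f j ≡ 0
  vanish j j≢i = n<1⇒n≡0 (≰⇒> λ fj≥1 → j≢i (unique j i fj≥1 fi≥1))

sum-↑ : ∀ a b (f : Fin (a + b) → ℕ) → sum f ≡ sum (f ∘ (_↑ˡ b)) + sum (f ∘ (a ↑ʳ_))
sum-↑ zero b f = refl
sum-↑ (suc a) b f = trans (cong (f fzero +_) (sum-↑ a b (f ∘ fsuc))) (sym (+-assoc (f fzero) _ _))

sum-𝟙-unique : ∀ {k} {P : Fin k → Set} (P? : ∀ i → Dec (P i)) a → P a → (∀ i → P i → i ≡ a) →
               sum (λ i → 𝟙 (P? i)) ≡ 1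
sum-𝟙-unique P? a Pa unique =
  trans (sum-single _ a λ i i≢a → 𝟙-no (P? i) (i≢a ∘ unique i)) (𝟙-yes (P? a) Pa)

sum-𝟙-toℕ≡ : ∀ {k} r → r < k → sum {k} (λ i → 𝟙 (toℕ i ≟ r)) ≡ 1
sum-𝟙-toℕ≡ r r<k = sum-𝟙-unique (λ i → toℕ i ≟ r) (fromℕ< r<k) (toℕ-fromℕ< r<k)
  λ i i≡r → toℕ-injective (trans i≡r (sym (toℕ-fromℕ< r<k)))

sum-𝟙-≡toℕ : ∀ {k} r → r < k → sum {k} (λ i → 𝟙 (r ≟ toℕ i)) ≡ 1
sum-𝟙-≡toℕ r r<k = sum-𝟙-unique (λ i → r ≟ toℕ i) (fromℕ< r<k) (sym (toℕ-fromℕ< r<k))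
  λ i r≡i → toℕ-injective (trans (sym r≡i) (sym (toℕ-fromℕ< r<k)))

module _ {t : ℕ} .{{_ : NonZero t}} where

  residue-class-size : ∀ k r → r < t → sum {k * t} (λ i → 𝟙 (toℕ i % t ≟ r)) ≡ k
  residue-class-size zero r r<t = refl
  residue-class-size (suc k) r r<t = begin
    sum {t + k * t} (λ i → 𝟙 (toℕ i % t ≟ r))
      ≡⟨ sum-↑ t (k * t) _ ⟩
    sum (λ (i : Fin t) → 𝟙 (toℕ (i ↑ˡ k * t) % t ≟ r)) + sum (λ (j : Fin (k * t)) → 𝟙 (toℕ (t ↑ʳ j) % t ≟ r))
      ≡⟨ cong₂ _+_ (sum-cong-≗ first-block) (sum-cong-≗ later-blocks) ⟩
    sum {t} (λ i → 𝟙 (toℕ i ≟ r)) + sum {k * t} (λ j → 𝟙 (toℕ j % t ≟ r))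
      ≡⟨ cong₂ _+_ (sum-𝟙-toℕ≡ r r<t) (residue-class-size k r r<t) ⟩
    suc k ∎
    where
    open ≡-Reasoning
    first-block : ∀ (i : Fin t) → 𝟙 (toℕ (i ↑ˡ k * t) % t ≟ r) ≡ 𝟙 (toℕ i ≟ r)
    first-block i = cong (λ x → 𝟙 (x ≟ r)) (trans (cong (_% t) (toℕ-↑ˡ i (k * t))) (m<n⇒m%n≡m (toℕ<n i)))
    later-blocks : ∀ (j : Fin (k * t)) → 𝟙 (toℕ (t ↑ʳ j) % t ≟ r) ≡ 𝟙 (toℕ j % t ≟ r)
    later-blocks j = cong (λ x → 𝟙 (x ≟ r))
      (trans (cong (_% t) (trans (toℕ-↑ʳ t j) (+-comm t (toℕ j)))) ([m+n]%n≡m%n (toℕ j) t))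

module _ (t : ℕ) .{{_ : NonZero t}} {k : ℕ} (S : Subset k) where

  classCount : ℕ → ℕ
  classCount r = sum (λ s → 𝟙 (s ∈? S ×-dec toℕ s % t ≟ r))

  ResiduesDistinct : Set
  ResiduesDistinct = ∀ s s′ → s ∈ S → s′ ∈ S → s ≢ s′ → ¬ (t ∣ ∣ toℕ s - toℕ s′ ∣)

  sum-classCount : sum {t} (λ r → classCount (toℕ r)) ≡ ∣ S ∣
  sum-classCount = begin
    sum {t} (λ r → sum (λ s → 𝟙 (s ∈? S ×-dec toℕ s % t ≟ toℕ r)))
      ≡⟨ ∑-comm (λ (r : Fin t) s → 𝟙 (s ∈? S ×-dec toℕ s % t ≟ toℕ r)) ⟩
    sum {k} (λ s → sum {t} (λ r → 𝟙 (s ∈? S ×-dec toℕ s % t ≟ toℕ r)))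
      ≡⟨ sum-cong-≗ (λ s → sum-cong-≗ {t} λ r → 𝟙-× (s ∈? S) (toℕ s % t ≟ toℕ r)) ⟩
    sum {k} (λ s → sum {t} (λ r → 𝟙 (s ∈? S) * 𝟙 (toℕ s % t ≟ toℕ r)))
      ≡⟨ sum-cong-≗ (λ s → *-distribˡ-sum (𝟙 (s ∈? S)) (λ (r : Fin t) → 𝟙 (toℕ s % t ≟ toℕ r))) ⟨
    sum {k} (λ s → 𝟙 (s ∈? S) * sum {t} (λ r → 𝟙 (toℕ s % t ≟ toℕ r)))
      ≡⟨ sum-cong-≗ (λ s → cong (𝟙 (s ∈? S) *_) (one-residue s)) ⟩
    sum {k} (λ s → 𝟙 (s ∈? S) * 1)
      ≡⟨ sum-cong-≗ (λ s → *-identityʳ (𝟙 (s ∈? S))) ⟩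
    sum {k} (λ s → 𝟙 (s ∈? S))
      ≡⟨ ∣S∣≡sum𝟙 S ⟨
    ∣ S ∣ ∎
    where
    open ≡-Reasoning
    one-residue : ∀ s → sum {t} (λ r → 𝟙 (toℕ s % t ≟ toℕ r)) ≡ 1
    one-residue s = sum-𝟙-≡toℕ (toℕ s % t) (m%n<n (toℕ s) t)

  classCount-witness : ∀ r → 1 ≤ classCount r → ∃ λ s → s ∈ S × toℕ s % t ≡ r
  classCount-witness r h with 1≤sum⇒∃ _ h
  ... | s , hs = s , 𝟙-witness (s ∈? S ×-dec toℕ s % t ≟ r) hs

  ResiduesDistinct⇒classCount≤1 : ResiduesDistinct → ∀ r → classCount r ≤ 1
  ResiduesDistinct⇒classCount≤1 distinct r =
    sum≤1 _ (λ s → 𝟙≤1 (s ∈? S ×-dec toℕ s % t ≟ r)) λ s s′ hs hs′ →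
      let s∈S , s≡r = 𝟙-witness (s ∈? S ×-dec toℕ s % t ≟ r) hs
          s′∈S , s′≡r = 𝟙-witness (s′ ∈? S ×-dec toℕ s′ % t ≟ r) hs′
      in decidable-stable (s ≟ᶠ s′) λ s≢s′ →
           distinct s s′ s∈S s′∈S s≢s′ (≡[mod]⇒∣∣-∣ (toℕ s) (toℕ s′) (mod-≡ (trans s≡r (sym s′≡r))))

  classCount≤1⇒ResiduesDistinct : (∀ r → r < t → classCount r ≤ 1) → ResiduesDistinct
  classCount≤1⇒ResiduesDistinct ≤1 s s′ s∈S s′∈S s≢s′ t∣s-s′ =
    <-irrefl refl (≤-trans (2≤sum _ s s′ s≢s′ (in-class s s∈S refl) (in-class s′ s′∈S s′≡s))
                           (≤1 r (m%n<n (toℕ s) t)))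
    where
    r : ℕ
    r = toℕ s % t
    s′≡s : toℕ s′ % t ≡ r
    s′≡s = sym (%-≡ (∣∣-∣⇒≡[mod] (toℕ s) (toℕ s′) t∣s-s′))
    in-class : ∀ x → x ∈ S → toℕ x % t ≡ r → 1 ≤ 𝟙 (x ∈? S ×-dec toℕ x % t ≟ r)
    in-class x x∈S x≡r = ≤-reflexive (sym (𝟙-yes (x ∈? S ×-dec toℕ x % t ≟ r) (x∈S , x≡r)))

  classCount≤1⇒classCount≡1 : ∣ S ∣ ≡ t → (∀ r → classCount r ≤ 1) → ∀ r → r < t → classCount r ≡ 1
  classCount≤1⇒classCount≡1 ∣S∣≡t ≤1 r r<t = begin
    classCount r                      ≡⟨ cong classCount (toℕ-fromℕ< r<t) ⟨
    classCount (toℕ (fromℕ< r<t))     ≡⟨ sum-mono-≤-≡⇒≡ (λ r → ≤1 (toℕ r)) total (fromℕ< r<t) ⟩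
    1                                 ∎
    where
    open ≡-Reasoning
    total : sum {t} (λ r → classCount (toℕ r)) ≡ sum {t} (λ _ → 1)
    total = trans sum-classCount (trans ∣S∣≡t (sym (sum-replicate-1 t)))

  residues-attained : ∣ S ∣ ≡ t → ResiduesDistinct → ∀ r → r < t → ∃ λ s → s ∈ S × toℕ s % t ≡ r
  residues-attained ∣S∣≡t distinct r r<t = classCount-witness r (≤-reflexive (sym
    (classCount≤1⇒classCount≡1 ∣S∣≡t (ResiduesDistinct⇒classCount≤1 distinct) r r<t)))

module _ {n : ℕ} where

  private
    G : Set
    G = Fin (suc n)

  sum-translate : ∀ (f : G → ℕ) a → sum (λ x → f (a ⊕ x)) ≡ sum f
  sum-translate f a = sym (sum-permute f (permutation (a ⊕_) (_⊖ a) (a⊕[b⊖a]≡b a) ([a⊕b]⊖a≡b a)))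

  sum-reflect : ∀ (f : G → ℕ) a → sum (λ u → f (a ⊖ u)) ≡ sum f
  sum-reflect f a = sym (sum-permute f (permutation (a ⊖_) (a ⊖_) (a⊖[a⊖b]≡b a) (a⊖[a⊖b]≡b a)))

  δ : G → G → ℕ
  δ a v = 𝟙 (v ≟ᶠ a)

  sum-δ : ∀ a → sum (δ a) ≡ 1
  sum-δ a = sum-𝟙-unique (_≟ᶠ a) a refl λ _ v≡a → v≡a

  infixl 7 _⋆_
  _⋆_ : (G → ℕ) → (G → ℕ) → G → ℕ
  (f ⋆ g) v = sum (λ u → f u * g (v ⊖ u))

  ⋆-cong : ∀ {f f′ g g′} → (∀ u → f u ≡ f′ u) → (∀ u → g u ≡ g′ u) →
           ∀ v → (f ⋆ g) v ≡ (f′ ⋆ g′) v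
  ⋆-cong f≗f′ g≗g′ v = sum-cong-≗ λ u → cong₂ _*_ (f≗f′ u) (g≗g′ (v ⊖ u))

  ⋆-cong-≡[mod] : ∀ {q} .{{_ : NonZero q}} {f f′ g g′} →
                  (∀ u → f u ≡ f′ u [mod q ]) → (∀ u → g u ≡ g′ u [mod q ]) →
                  ∀ v → (f ⋆ g) v ≡ (f′ ⋆ g′) v [mod q ]
  ⋆-cong-≡[mod] f≡f′ g≡g′ v = sum-cong-≡[mod] λ u → *-cong-≡[mod] (f≡f′ u) (g≡g′ (v ⊖ u))

  ⋆-comm : ∀ f g v → (f ⋆ g) v ≡ (g ⋆ f) v
  ⋆-comm f g v = begin
    sum (λ u → f u * g (v ⊖ u))
      ≡⟨ sum-reflect (λ u → f u * g (v ⊖ u)) v ⟨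
    sum (λ u → f (v ⊖ u) * g (v ⊖ (v ⊖ u)))
      ≡⟨ sum-cong-≗ (λ u → cong (λ w → f (v ⊖ u) * g w) (a⊖[a⊖b]≡b v u)) ⟩
    sum (λ u → f (v ⊖ u) * g u)
      ≡⟨ sum-cong-≗ (λ u → *-comm (f (v ⊖ u)) (g u)) ⟩
    sum (λ u → g u * f (v ⊖ u)) ∎
    where open ≡-Reasoning

  ⋆-assoc : ∀ f g h v → ((f ⋆ g) ⋆ h) v ≡ (f ⋆ (g ⋆ h)) v
  ⋆-assoc f g h v = begin
    sum (λ u → sum (λ w → f w * g (u ⊖ w)) * h (v ⊖ u))
      ≡⟨ sum-cong-≗ (λ u → *-distribʳ-sum (h (v ⊖ u)) (λ w → f w * g (u ⊖ w))) ⟩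
    sum (λ u → sum (λ w → f w * g (u ⊖ w) * h (v ⊖ u)))
      ≡⟨ ∑-comm (λ u w → f w * g (u ⊖ w) * h (v ⊖ u)) ⟩
    sum (λ w → sum (λ u → f w * g (u ⊖ w) * h (v ⊖ u)))
      ≡⟨ sum-cong-≗ inner ⟩
    sum (λ w → f w * sum (λ x → g x * h ((v ⊖ w) ⊖ x))) ∎
    where
    open ≡-Reasoning
    inner : ∀ w → sum (λ u → f w * g (u ⊖ w) * h (v ⊖ u)) ≡ f w * sum (λ x → g x * h ((v ⊖ w) ⊖ x))
    inner w = begin
      sum (λ u → f w * g (u ⊖ w) * h (v ⊖ u))
        ≡⟨ sum-translate (λ u → f w * g (u ⊖ w) * h (v ⊖ u)) w ⟨
      sum (λ x → f w * g ((w ⊕ x) ⊖ w) * h (v ⊖ (w ⊕ x)))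
        ≡⟨ sum-cong-≗ (λ x → cong₂ (λ a b → f w * g a * h b) ([a⊕b]⊖a≡b w x) (a⊖[b⊕c]≡a⊖b⊖c v w x)) ⟩
      sum (λ x → f w * g x * h ((v ⊖ w) ⊖ x))
        ≡⟨ sum-cong-≗ (λ x → *-assoc (f w) (g x) (h ((v ⊖ w) ⊖ x))) ⟩
      sum (λ x → f w * (g x * h ((v ⊖ w) ⊖ x)))
        ≡⟨ *-distribˡ-sum (f w) (λ x → g x * h ((v ⊖ w) ⊖ x)) ⟨
      f w * sum (λ x → g x * h ((v ⊖ w) ⊖ x)) ∎

  ⋆-distribʳ : ∀ f g h v → ((λ u → g u + h u) ⋆ f) v ≡ (g ⋆ f) v + (h ⋆ f) v
  ⋆-distribʳ f g h v = trans (sum-cong-≗ λ u → *-distribʳ-+ (f (v ⊖ u)) (g u) (h u))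
    (∑-distrib-+ (λ u → g u * f (v ⊖ u)) (λ u → h u * f (v ⊖ u)))

  δ-⋆ : ∀ a f v → (δ a ⋆ f) v ≡ f (v ⊖ a)
  δ-⋆ a f v = begin
    sum (λ u → δ a u * f (v ⊖ u))   ≡⟨ sum-single _ a (λ u u≢a → cong (_* f (v ⊖ u)) (𝟙-no (u ≟ᶠ a) u≢a)) ⟩
    δ a a * f (v ⊖ a)               ≡⟨ cong (_* f (v ⊖ a)) (𝟙-yes (a ≟ᶠ a) refl) ⟩
    1 * f (v ⊖ a)                   ≡⟨ *-identityˡ (f (v ⊖ a)) ⟩
    f (v ⊖ a)                       ∎
    where open ≡-Reasoning

  δ-⋆-δ : ∀ a b v → (δ a ⋆ δ b) v ≡ δ (a ⊕ b) v
  δ-⋆-δ a b v = trans (δ-⋆ a (δ b) v) (𝟙-cong ((v ⊖ a) ≟ᶠ b) (v ≟ᶠ a ⊕ b) (mk⇔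
    (λ v⊖a≡b → trans (sym (a⊕[b⊖a]≡b a v)) (cong (a ⊕_) v⊖a≡b))
    (λ v≡a⊕b → trans (cong (_⊖ a) v≡a⊕b) ([a⊕b]⊖a≡b a b))))

  ⋆-const : ∀ f c v → (f ⋆ (λ _ → c)) v ≡ sum f * c
  ⋆-const f c v = sym (*-distribʳ-sum c f)

  sum-⋆ : ∀ f g → sum (f ⋆ g) ≡ sum f * sum g
  sum-⋆ f g = begin
    sum (λ v → sum (λ u → f u * g (v ⊖ u)))   ≡⟨ ∑-comm (λ v u → f u * g (v ⊖ u)) ⟩
    sum (λ u → sum (λ v → f u * g (v ⊖ u)))   ≡⟨ sum-cong-≗ (λ u → *-distribˡ-sum (f u) (λ v → g (v ⊖ u))) ⟨
    sum (λ u → f u * sum (λ v → g (v ⊖ u)))   ≡⟨ sum-cong-≗ (λ u → cong (f u *_) (sum-translate-⊖ u)) ⟩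
    sum (λ u → f u * sum g)                   ≡⟨ *-distribʳ-sum (sum g) f ⟨
    sum f * sum g                             ∎
    where
    open ≡-Reasoning
    sum-translate-⊖ : ∀ u → sum (λ v → g (v ⊖ u)) ≡ sum g
    sum-translate-⊖ u = trans (sym (sum-translate (λ v → g (v ⊖ u)) u)) (sum-cong-≗ λ x → cong g ([a⊕b]⊖a≡b u x))

  δ-expansion : ∀ (f : G → ℕ) v → sum (λ c → f c * δ c v) ≡ f v
  δ-expansion f v = trans (sum-single _ v λ c c≢v → trans (cong (f c *_) (𝟙-no (v ≟ᶠ c) (c≢v ∘ sym))) (*-zeroʳ (f c)))
    (trans (cong (f v *_) (𝟙-yes (v ≟ᶠ v) refl)) (*-identityʳ (f v)))

  ⋆-zeroˡ : ∀ f v → ((λ _ → 0) ⋆ f) v ≡ 0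
  ⋆-zeroˡ f v = sum-replicate-zero (suc n)

  ⋆-identityˡ : ∀ f v → (δ fzero ⋆ f) v ≡ f v
  ⋆-identityˡ f v = trans (δ-⋆ fzero f v) (cong f (a⊖0≡a v))

*-congˡ-positive : ∀ m {n o} → (1 ≤ m → n ≡ o) → m * n ≡ m * o
*-congˡ-positive zero _ = refl
*-congˡ-positive (suc m) n≡o = cong (suc m *_) (n≡o (s≤s z≤n))

module _ {n t : ℕ} .{{_ : NonZero t}} (t∣N : t ∣ suc n) where

  private
    ρ : ℕ → Fin (suc n) → ℕ
    ρ r v = 𝟙 (toℕ v % t ≟ r)

  residue-translate : ∀ r u w → t ∣ toℕ u → ρ r (u ⊕ w) ≡ ρ r w
  residue-translate r u w t∣u = cong (λ x → 𝟙 (x ≟ r)) (%-≡ (begin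
    toℕ (u ⊕ w)       ≈⟨ ≡[mod]-∣ t∣N (toℕ-⊕ u w) ⟩
    toℕ u + toℕ w     ≡⟨ +-comm (toℕ u) (toℕ w) ⟩
    toℕ w + toℕ u     ≈⟨ ∣n⇒m+n≡m[mod] (toℕ w) t∣u ⟩
    toℕ w             ∎))
    where open SetoidReasoning (≡[mod]-setoid {t})

  -- Convolving with a function supported on the subgroup tℤₙ does not mix residue classes modulo t.
  residue-⋆ : ∀ (Y f : Fin (suc n) → ℕ) → (∀ u → 1 ≤ Y u → t ∣ toℕ u) → ∀ r →
              sum (λ v → (Y ⋆ f) v * ρ r v) ≡ sum Y * sum (λ w → f w * ρ r w)
  residue-⋆ Y f supported r = begin
    sum (λ v → sum (λ u → Y u * f (v ⊖ u)) * ρ r v)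
      ≡⟨ sum-cong-≗ (λ v → *-distribʳ-sum (ρ r v) (λ u → Y u * f (v ⊖ u))) ⟩
    sum (λ v → sum (λ u → Y u * f (v ⊖ u) * ρ r v))
      ≡⟨ ∑-comm (λ v u → Y u * f (v ⊖ u) * ρ r v) ⟩
    sum (λ u → sum (λ v → Y u * f (v ⊖ u) * ρ r v))
      ≡⟨ sum-cong-≗ (λ u → sum-cong-≗ λ v → *-assoc (Y u) (f (v ⊖ u)) (ρ r v)) ⟩
    sum (λ u → sum (λ v → Y u * (f (v ⊖ u) * ρ r v)))
      ≡⟨ sum-cong-≗ (λ u → *-distribˡ-sum (Y u) (λ v → f (v ⊖ u) * ρ r v)) ⟨
    sum (λ u → Y u * sum (λ v → f (v ⊖ u) * ρ r v))
      ≡⟨ sum-cong-≗ (λ u → *-congˡ-positive (Y u) (shift u ∘ supported u)) ⟩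
    sum (λ u → Y u * F)
      ≡⟨ *-distribʳ-sum F Y ⟨
    sum Y * F ∎
    where
    open ≡-Reasoning
    F : ℕ
    F = sum (λ w → f w * ρ r w)
    shift : ∀ u → t ∣ toℕ u → sum (λ v → f (v ⊖ u) * ρ r v) ≡ F
    shift u t∣u = begin
      sum (λ v → f (v ⊖ u) * ρ r v)
        ≡⟨ sum-translate (λ v → f (v ⊖ u) * ρ r v) u ⟨
      sum (λ w → f ((u ⊕ w) ⊖ u) * ρ r (u ⊕ w))
        ≡⟨ sum-cong-≗ (λ w → cong₂ _*_ (cong f ([a⊕b]⊖a≡b u w)) (residue-translate r u w t∣u)) ⟩
      F ∎

module _ (n q : ℕ) .{{_ : NonZero q}} where

  private
    R : Set
    R = Fin (suc n) → ℕ

    _≈_ : R → R → Set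
    f ≈ g = ∀ v → f v ≡ g v [mod q ]

    lift : ∀ {f g : R} → (∀ v → f v ≡ g v) → f ≈ g
    lift f≗g v = ≡⇒≡[mod] (f≗g v)

    ≈-isEquivalence : IsEquivalence _≈_
    ≈-isEquivalence = record
      { refl = λ v → ≡[mod]-refl
      ; sym = λ f≈g v → ≡[mod]-sym (f≈g v)
      ; trans = λ f≈g g≈h v → ≡[mod]-trans (f≈g v) (g≈h v) }

  groupSemiring : CommutativeSemiring 0ℓ 0ℓ
  groupSemiring = record
    { Carrier = R
    ; _≈_ = _≈_
    ; _+_ = λ f g v → f v + g v
    ; _*_ = _⋆_
    ; 0# = λ _ → 0
    ; 1# = δ fzero
    ; isCommutativeSemiring = IsCommutativeSemiringˡ.isCommutativeSemiring (record
      { +-isCommutativeMonoid = record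
        { isMonoid = record
          { isSemigroup = record
            { isMagma = record
              { isEquivalence = ≈-isEquivalence
              ; ∙-cong = λ f≈f′ g≈g′ v → +-cong-≡[mod] (f≈f′ v) (g≈g′ v) }
            ; assoc = λ f g h → lift λ v → +-assoc (f v) (g v) (h v) }
          ; identity = (λ f → lift λ v → refl) , (λ f → lift λ v → +-identityʳ (f v)) }
        ; comm = λ f g → lift λ v → +-comm (f v) (g v) }
      ; *-isCommutativeMonoid = record
        { isMonoid = record
          { isSemigroup = record
            { isMagma = record { isEquivalence = ≈-isEquivalence ; ∙-cong = ⋆-cong-≡[mod] }
            ; assoc = λ f g h → lift (⋆-assoc f g h) }
          ; identity = (λ f → lift (⋆-identityˡ f))
                     , (λ f → lift λ v → trans (⋆-comm f (δ fzero) v) (⋆-identityˡ f v)) }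
        ; comm = λ f g → lift (⋆-comm f g) }
      ; distribʳ = λ f g h → lift (⋆-distribʳ f g h)
      ; zeroˡ = λ f → lift (⋆-zeroˡ f) }) }

module _ (n : ℕ) {p : ℕ} (p-prime : Prime p) where

  private
    instance
      p≢0 : NonZero p
      p≢0 = prime⇒nonZero p-prime

    ℕ[ℤₙ] : CommutativeSemiring 0ℓ 0ℓ
    ℕ[ℤₙ] = groupSemiring n p

    module R = CommutativeSemiring ℕ[ℤₙ]
    open Frobenius ℕ[ℤₙ] using (frobenius; AdditivePower-^; AdditivePower-sum)
    open import Algebra.Definitions.RawSemiring R.rawSemiring using (_^_) renaming (_×_ to _·_; sum to ∑)
    open import Algebra.Properties.Semiring.Exp R.semiring using (^-congˡ)

  ·-apply : ∀ k f v → (k · f) v ≡ k * f v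
  ·-apply zero f v = refl
  ·-apply (suc k) f v = cong (f v +_) (·-apply k f v)

  ∑-apply : ∀ {k} (T : Fin k → Fin (suc n) → ℕ) v → ∑ T v ≡ sum (λ i → T i v)
  ∑-apply {zero} T v = refl
  ∑-apply {suc k} T v = cong (T fzero v +_) (∑-apply (T ∘ fsuc) v)

  sum-^ : ∀ f k → sum (f ^ k) ≡ sum f ^ℕ k
  sum-^ f zero = sum-δ {n} fzero
  sum-^ f (suc k) = trans (sum-⋆ f (f ^ k)) (cong (sum f *_) (sum-^ f k))

  δ-^ : ∀ k c v → (δ c ^ k) v ≡ δ (k ⊛ c) v
  δ-^ zero c v = refl
  δ-^ (suc k) c v = begin
    (δ c ⋆ δ c ^ k) v       ≡⟨ ⋆-cong {f = δ c} (λ _ → refl) (δ-^ k c) v ⟩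
    (δ c ⋆ δ (k ⊛ c)) v     ≡⟨ δ-⋆-δ c (k ⊛ c) v ⟩
    δ (c ⊕ k ⊛ c) v         ≡⟨ cong (λ a → δ a v) (c⊕k⊛c≡[1+k]⊛c k c) ⟩
    δ (suc k ⊛ c) v         ∎
    where open ≡-Reasoning

  characteristic : ∀ f → p · f R.≈ R.0#
  characteristic f v = ≡[mod]-trans (≡⇒≡[mod] (·-apply p f v)) (∣⇒≡0[mod] (m∣m*n (f v)))

  frobenius-^ : ∀ l → Frobenius.AdditivePower ℕ[ℤₙ] (p ^ℕ l)
  frobenius-^ = AdditivePower-^ (frobenius (nonTrivial⇒n>1 p {{prime⇒nonTrivial p-prime}}) (prime∣pCk p-prime) characteristic)

  ^-cong-≗ : ∀ {f g} → (∀ v → f v ≡ g v) → ∀ k v → (f ^ k) v ≡ (g ^ k) v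
  ^-cong-≗ f≗g zero v = refl
  ^-cong-≗ f≗g (suc k) v = ⋆-cong f≗g (^-cong-≗ f≗g k) v

  0^ : ∀ k → 1 ≤ k → ∀ v → ((λ _ → 0) ^ k) v ≡ 0
  0^ (suc k) _ v = ⋆-zeroˡ ((λ _ → 0) ^ k) v

  𝟙·δ-^ : ∀ {P} (P? : Dec P) c k → 1 ≤ k → ∀ v → ((𝟙 P? · δ c) ^ k) v ≡ 𝟙 P? * δ (k ⊛ c) v
  𝟙·δ-^ (yes _) c k _ v = trans (^-cong-≗ (λ u → +-identityʳ (δ c u)) k v) (trans (δ-^ k c v) (sym (+-identityʳ _)))
  𝟙·δ-^ (no _) c k 1≤k v = 0^ k 1≤k v

  subset-^ : ∀ (𝒞 : Subset (suc n)) l v →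
             ((λ u → 𝟙 (u ∈? 𝒞)) ^ (p ^ℕ l)) v ≡ sum (λ c → 𝟙 (c ∈? 𝒞) * δ (p ^ℕ l ⊛ c) v) [mod p ]
  subset-^ 𝒞 l v = begin
    (X ^ e) v                          ≈⟨ ^-congˡ e X≈∑T v ⟩
    (∑ T ^ e) v                        ≈⟨ AdditivePower-sum (m^n>0 p l) (frobenius-^ l) T v ⟩
    ∑ (λ c → T c ^ e) v                ≡⟨ ∑-apply (λ c → T c ^ e) v ⟩
    sum (λ c → (T c ^ e) v)            ≡⟨ sum-cong-≗ (λ c → 𝟙·δ-^ (c ∈? 𝒞) c e (m^n>0 p l) v) ⟩
    sum (λ c → 𝟙 (c ∈? 𝒞) * δ (e ⊛ c) v) ∎
    where
    open SetoidReasoning (≡[mod]-setoid {p})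
    e : ℕ
    e = p ^ℕ l
    X : Fin (suc n) → ℕ
    X u = 𝟙 (u ∈? 𝒞)
    T : Fin (suc n) → Fin (suc n) → ℕ
    T c = 𝟙 (c ∈? 𝒞) · δ c
    X≈∑T : X R.≈ ∑ T
    X≈∑T u = ≡⇒≡[mod] (sym (trans (∑-apply T u)
      (trans (sum-cong-≗ λ c → ·-apply (𝟙 (c ∈? 𝒞)) (δ c) u) (δ-expansion X u))))

  ^-⋆-tiling : ∀ {f g : Fin (suc n) → ℕ} → (∀ v → (f ⋆ g) v ≡ 1) →
               ∀ e v → ((f ^ suc e) ⋆ g) v ≡ sum f ^ℕ e
  ^-⋆-tiling {f} {g} f⋆g≡1 e v = begin
    ((f ⋆ f ^ e) ⋆ g) v       ≡⟨ ⋆-cong {g = g} (⋆-comm f (f ^ e)) (λ _ → refl) v ⟩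
    ((f ^ e ⋆ f) ⋆ g) v       ≡⟨ ⋆-assoc (f ^ e) f g v ⟩
    (f ^ e ⋆ (f ⋆ g)) v       ≡⟨ ⋆-cong {f = f ^ e} (λ _ → refl) f⋆g≡1 v ⟩
    (f ^ e ⋆ (λ _ → 1)) v     ≡⟨ ⋆-const (f ^ e) 1 v ⟩
    sum (f ^ e) * 1           ≡⟨ *-identityʳ _ ⟩
    sum (f ^ e)               ≡⟨ sum-^ f e ⟩
    sum f ^ℕ e                ∎
    where open ≡-Reasoning

module FromTotalPerfectCode {m l p : ℕ} (p-prime : Prime p)
               (t∣N : p ^ℕ l ∣ suc m) (pt∤N : ¬ (p ^ℕ suc l ∣ suc m))
               {S : Subset (suc m)} (S-symmetric : ∀ s → s ∈ S → (⊝ s) ∈ S) (∣S∣≡t : ∣ S ∣ ≡ p ^ℕ l)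
               {𝒞 : Subset (suc m)} (𝒞-code : IsTotalPerfectCode S 𝒞) where

  private
    t N : ℕ
    t = p ^ℕ l
    N = suc m

    instance
      p≢0 : NonZero p
      p≢0 = prime⇒nonZero p-prime
      t≢0 : NonZero t
      t≢0 = m^n≢0 p l

    X 𝟙S : Fin N → ℕ
    X v = 𝟙 (v ∈? 𝒞)
    𝟙S v = 𝟙 (v ∈? S)

    open import Algebra.Definitions.RawSemiring (CommutativeSemiring.rawSemiring (groupSemiring m p)) using (_^_)

    sum-𝟙S : sum 𝟙S ≡ t
    sum-𝟙S = trans (sym (∣S∣≡sum𝟙 S)) ∣S∣≡t

  tiling : ∀ v → (X ⋆ 𝟙S) v ≡ 1
  tiling v with 𝒞-code v
  ... | c , (c∈𝒞 , c-adj) , unique =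
    trans (sum-single _ c vanish) (cong₂ _*_ (𝟙-yes (c ∈? 𝒞) c∈𝒞) (𝟙-yes ((v ⊖ c) ∈? S) v⊖c∈S))
    where
    v⊖c∈S : (v ⊖ c) ∈ S
    v⊖c∈S = subst (_∈ S) (⊝[a⊖b]≡b⊖a c v) (S-symmetric (c ⊖ v) c-adj)
    vanish : ∀ u → u ≢ c → X u * 𝟙S (v ⊖ u) ≡ 0
    vanish u u≢c = trans (sym (𝟙-× (u ∈? 𝒞) ((v ⊖ u) ∈? S))) (𝟙-no (u ∈? 𝒞 ×-dec (v ⊖ u) ∈? S)
      λ (u∈𝒞 , v⊖u∈S) → u≢c (unique u u∈𝒞 (subst (_∈ S) (⊝[a⊖b]≡b⊖a v u) (S-symmetric (v ⊖ u) v⊖u∈S))))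

  k : ℕ
  k = sum X

  k*t≡N : k * t ≡ N
  k*t≡N = begin
    k * t             ≡⟨ cong (k *_) sum-𝟙S ⟨
    k * sum 𝟙S        ≡⟨ sum-⋆ X 𝟙S ⟨
    sum (X ⋆ 𝟙S)      ≡⟨ sum-cong-≗ tiling ⟩
    sum {N} (λ _ → 1) ≡⟨ sum-replicate-1 N ⟩
    N                 ∎
    where open ≡-Reasoning

  p∤k : ¬ p ∣ k
  p∤k p∣k = pt∤N (subst (p * t ∣_) k*t≡N (*-monoˡ-∣ t p∣k))

  -- X ^ t reduced modulo p, by subset-^.
  Y : Fin N → ℕ
  Y v = sum (λ c → X c * δ (t ⊛ c) v)

  sum-Y : sum Y ≡ k
  sum-Y = begin
    sum (λ v → sum (λ c → X c * δ (t ⊛ c) v))   ≡⟨ ∑-comm (λ v c → X c * δ (t ⊛ c) v) ⟩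
    sum (λ c → sum (λ v → X c * δ (t ⊛ c) v))   ≡⟨ sum-cong-≗ (λ c → *-distribˡ-sum (X c) (δ (t ⊛ c))) ⟨
    sum (λ c → X c * sum (δ (t ⊛ c)))           ≡⟨ sum-cong-≗ (λ c → cong (X c *_) (sum-δ (t ⊛ c))) ⟩
    sum (λ c → X c * 1)                         ≡⟨ sum-cong-≗ (λ c → *-identityʳ (X c)) ⟩
    k                                           ∎
    where open ≡-Reasoning

  Y-supported : ∀ u → 1 ≤ Y u → t ∣ toℕ u
  Y-supported u 1≤Yu with 1≤sum⇒∃ (λ c → X c * δ (t ⊛ c) u) 1≤Yu
  ... | c , 1≤Xc*δ
    with 𝟙-witness (c ∈? 𝒞 ×-dec u ≟ᶠ t ⊛ c) (subst (1 ≤_) (sym (𝟙-× (c ∈? 𝒞) (u ≟ᶠ t ⊛ c))) 1≤Xc*δ)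
  ... | _ , refl = ≡0[mod]⇒∣ (begin
    toℕ (t ⊛ c)    ≈⟨ ≡[mod]-∣ t∣N (toℕ-mod (t * toℕ c)) ⟩
    t * toℕ c      ≈⟨ ∣⇒≡0[mod] (m∣m*n (toℕ c)) ⟩
    0              ∎)
    where open SetoidReasoning (≡[mod]-setoid {t})

  Y⋆S≡1 : ∀ v → (Y ⋆ 𝟙S) v ≡ 1
  Y⋆S≡1 v = sym (sum-mono-≤-≡⇒≡ positive total v)
    where
    e : ℕ
    e = t ∸ 1
    t≡1+e : t ≡ suc e
    t≡1+e = sym (m+[n∸m]≡n (m^n>0 p l))
    X^t⋆S : ∀ v → ((X ^ t) ⋆ 𝟙S) v ≡ k ^ℕ e
    X^t⋆S v = subst (λ j → ((X ^ j) ⋆ 𝟙S) v ≡ k ^ℕ e) (sym t≡1+e) (^-⋆-tiling m p-prime {X} {𝟙S} tiling e v)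
    positive : ∀ v → 1 ≤ (Y ⋆ 𝟙S) v
    positive v = ∤∧≡[mod]⇒1≤ (prime∤^ p-prime p∤k e) (begin
      k ^ℕ e                ≡⟨ X^t⋆S v ⟨
      ((X ^ t) ⋆ 𝟙S) v      ≈⟨ ⋆-cong-≡[mod] {g = 𝟙S} (subset-^ m p-prime 𝒞 l) (λ _ → ≡[mod]-refl) v ⟩
      (Y ⋆ 𝟙S) v            ∎)
      where open SetoidReasoning (≡[mod]-setoid {p})
    total : sum {N} (λ _ → 1) ≡ sum (Y ⋆ 𝟙S)
    total = begin
      sum {N} (λ _ → 1)     ≡⟨ sum-replicate-1 N ⟩
      N                     ≡⟨ k*t≡N ⟨
      k * t                 ≡⟨ cong₂ _*_ sum-Y sum-𝟙S ⟨
      sum Y * sum 𝟙S        ≡⟨ sum-⋆ Y 𝟙S ⟨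
      sum (Y ⋆ 𝟙S)          ∎
      where open ≡-Reasoning

  k≢0 : NonZero k
  k≢0 = m*n≢0⇒m≢0 k {{subst NonZero (sym k*t≡N) _}}

  classCount≡1 : ∀ r → r < t → classCount t S r ≡ 1
  classCount≡1 r r<t = *-cancelˡ-≡ (classCount t S r) 1 k {{k≢0}} (begin
    k * classCount t S r
      ≡⟨ cong₂ _*_ sum-Y (sym (sum-cong-≗ λ w → 𝟙-× (w ∈? S) (toℕ w % t ≟ r))) ⟨
    sum Y * sum (λ w → 𝟙S w * 𝟙 (toℕ w % t ≟ r))
      ≡⟨ residue-⋆ t∣N Y 𝟙S Y-supported r ⟨
    sum (λ v → (Y ⋆ 𝟙S) v * 𝟙 (toℕ v % t ≟ r))
      ≡⟨ sum-cong-≗ (λ v → trans (cong (_* 𝟙 (toℕ v % t ≟ r)) (Y⋆S≡1 v)) (*-identityˡ _)) ⟩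
    sum {N} (λ v → 𝟙 (toℕ v % t ≟ r))
      ≡⟨ subst (λ N′ → sum {N′} (λ v → 𝟙 (toℕ v % t ≟ r)) ≡ k) k*t≡N (residue-class-size k r r<t) ⟩
    k
      ≡⟨ *-identityʳ k ⟨
    k * 1 ∎)
    where open ≡-Reasoning

  residuesDistinct : ResiduesDistinct t S
  residuesDistinct = classCount≤1⇒ResiduesDistinct t S λ r r<t → ≤-reflexive (classCount≡1 r r<t)

module _ {k : ℕ} {P : Fin k → Set} (P? : ∀ i → Dec (P i)) where

  ∈-tabulate-does : ∀ i → i ∈ tabulate (does ∘ P?) → P i
  ∈-tabulate-does i i∈ with P? i | trans (sym (lookup∘tabulate (does ∘ P?) i)) ([]=⇒lookup i∈)
  ... | yes p | _ = p
  ... | no _ | ()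

  tabulate-does-∋ : ∀ i → P i → i ∈ tabulate (does ∘ P?)
  tabulate-does-∋ i Pi = lookup⇒[]= i _ (trans (lookup∘tabulate (does ∘ P?) i) (dec-true (P? i) Pi))

multiples : ∀ {n} → ℕ → Subset (suc n)
multiples t = tabulate (λ c → does (t ∣? toℕ c))

module _ {n t : ℕ} .{{_ : NonZero t}} (t∣N : t ∣ suc n) {S : Subset (suc n)} where

  private
    open SetoidReasoning (≡[mod]-setoid {t})

    toℕ-⊕-mod-divisor : ∀ (a b : Fin (suc n)) → toℕ (a ⊕ b) ≡ toℕ a + toℕ b [mod t ]
    toℕ-⊕-mod-divisor a b = ≡[mod]-∣ t∣N (toℕ-⊕ a b)

  multiples-isTotalPerfectCode : ResiduesDistinct t S → (∀ r → r < t → ∃ λ s → s ∈ S × toℕ s % t ≡ r) →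
                                 IsTotalPerfectCode S (multiples t)
  multiples-isTotalPerfectCode distinct attained v =
    v ⊕ s , (v⊕s∈C , subst (_∈ S) (sym ([a⊕b]⊖a≡b v s)) s∈S) , unique
    where
    r : ℕ
    r = (t ∸ toℕ v % t) % t
    s : Fin (suc n)
    s = proj₁ (attained r (m%n<n _ t))
    s∈S : s ∈ S
    s∈S = proj₁ (proj₂ (attained r (m%n<n _ t)))
    v+s≡0 : toℕ v + toℕ s ≡ 0 [mod t ]
    v+s≡0 = begin
      toℕ v + toℕ s                  ≈⟨ +-cong-≡[mod] (m%d≡m[mod] (toℕ v)) (m%d≡m[mod] (toℕ s)) ⟨
      toℕ v % t + toℕ s % t          ≡⟨ cong (toℕ v % t +_) (proj₂ (proj₂ (attained r (m%n<n _ t)))) ⟩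
      toℕ v % t + r                  ≈⟨ +-congˡ-≡[mod] (toℕ v % t) (m%d≡m[mod] (t ∸ toℕ v % t)) ⟩
      toℕ v % t + (t ∸ toℕ v % t)    ≡⟨ m+[n∸m]≡n (m%n≤n (toℕ v) t) ⟩
      t                              ≈⟨ ∣⇒≡0[mod] ∣-refl ⟩
      0                              ∎
    v⊕s∈C : v ⊕ s ∈ multiples t
    v⊕s∈C = tabulate-does-∋ (λ c → t ∣? toℕ c) (v ⊕ s)
      (≡0[mod]⇒∣ (≡[mod]-trans (toℕ-⊕-mod-divisor v s) v+s≡0))
    unique : ∀ c′ → c′ ∈ multiples t → (c′ ⊖ v) ∈ S → c′ ≡ v ⊕ s
    unique c′ c′∈C s′∈S = trans (sym (a⊕[b⊖a]≡b v c′)) (cong (v ⊕_) s′≡s)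
      where
      v+s′≡v+s : toℕ v + toℕ (c′ ⊖ v) ≡ toℕ v + toℕ s [mod t ]
      v+s′≡v+s = begin
        toℕ v + toℕ (c′ ⊖ v)   ≈⟨ toℕ-⊕-mod-divisor v (c′ ⊖ v) ⟨
        toℕ (v ⊕ (c′ ⊖ v))     ≡⟨ cong toℕ (a⊕[b⊖a]≡b v c′) ⟩
        toℕ c′                 ≈⟨ ∣⇒≡0[mod] (∈-tabulate-does (λ c → t ∣? toℕ c) c′ c′∈C) ⟩
        0                      ≈⟨ v+s≡0 ⟨
        toℕ v + toℕ s          ∎
      s′≡s : c′ ⊖ v ≡ s
      s′≡s = decidable-stable (c′ ⊖ v ≟ᶠ s) λ s′≢s →
        distinct (c′ ⊖ v) s s′∈S s∈S s′≢s (≡[mod]⇒∣∣-∣ _ _ (+-cancelˡ-≡[mod] (toℕ v) v+s′≡v+s))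

open import Data.Nat.Base using (_^_)

theorem1p4 : (m l p : ℕ) → 1 ≤ l → Prime p →
    (p ^ l) ∣ suc m → ¬ ((p ^ suc l) ∣ suc m) →
    (S : Subset (suc m)) → Fin.zero ∉ S →
    (∀ s → s ∈ S → (⊝ s) ∈ S) → ∣ S ∣ ≡ p ^ l →
    Connected S →
    HasTotalPerfectCode S ⇔
      (∀ s s′ → s ∈ S → s′ ∈ S → s ≢ s′ → ¬ ((p ^ l) ∣ ∣ toℕ s - toℕ s′ ∣))
theorem1p4 m l p _ p-prime t∣N pt∤N S _ S-symmetric ∣S∣≡t _ = mk⇔
  (λ (𝒞 , 𝒞-code) → FromTotalPerfectCode.residuesDistinct {l = l} p-prime t∣N pt∤N S-symmetric ∣S∣≡t 𝒞-code)
  (λ distinct → multiples (p ^ l) ,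
    multiples-isTotalPerfectCode t∣N distinct (residues-attained (p ^ l) S ∣S∣≡t distinct))
  where
  instance
    t≢0 : NonZero (p ^ l)
    t≢0 = m^n≢0 p l {{prime⇒nonZero p-prime}}
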